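{- Let $A$ be an animal with $|A|=a+1$, where $a\ge1$, and let $b\ge0$ be an integer. Assume $A$ has $k$ placements $A_1,\ldots,A_k$ on the board (sets of cells congruent to $A$) and there is a cell $x$ such that $A_i\cap A_j=\{x\}$ for all distinct $i,j\in\{1,\ldots,k\}$. If $ak>b$, then $A$ is an $(a,b)$-winner.
   Context: A board is one of the regular tilings: square tiling of the plane, triangular tiling of the plane, hexagonal tiling of the plane, or tiling of space by unit cubes; its tiles are cells. Two cells are adjacent if they share an edge (a face for cubes). An animal is a finite connected (under adjacency) set of cells, considered up to congruence; $|A|$ is its number of cells. In the weak $(a,b)$ achievement game for goal animal $A$ on the infinite board, the maker and breaker alternately mark previously unmarked cells, maker first; the maker marks $a$ cells per turn and the breaker $b$ cells per turn. The maker wins if the set of cells he has marked at some point contains a set congruent to $A$. $A$ is an $(a,b)$-winner if the maker has a strategy guaranteeing a win in finitely many turns against every breaker play; otherwise an $(a,b)$-loser. -}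

module Defs where

open import Data.Nat using (ℕ; zero; suc; _<_)
open import Data.Integer using (ℤ; _+_; _-_; 0ℤ; 1ℤ; -1ℤ)
open import Data.Bool using (Bool; true; false)
open import Data.Product using (Σ; ∃; ∃-syntax; _×_; _,_; proj₁; proj₂)
open import Data.Sum using (_⊎_)
open import Data.Empty using (⊥)
open import Data.List using (List; []; _∷_; _++_; length; concatMap; [_])
open import Data.List.Relation.Unary.Any using (Any)
open import Data.List.Relation.Unary.All using (All)
open import Data.List.Membership.Propositional using (_∈_; _∉_)
open import Data.List.Relation.Unary.Unique.Propositional using (Unique)
open import Relation.Binary.PropositionalEquality using (_≡_)

-- Boards: a set of cells together with the adjacency relation
-- (sharing an edge, resp. a face for cubes).

record Board : Set₁ where
  field
    Cell : Set
    Adj  : Cell → Cell → Set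

open Board public

-- Square tiling: cell (x , y) is the unit square [x,x+1]×[y,y+1].
Cell² : Set
Cell² = ℤ × ℤ

_⊕²_ : Cell² → Cell² → Cell²
(x , y) ⊕² (u , v) = (x + u , y + v)

squareOffsets : List Cell²
squareOffsets = (1ℤ , 0ℤ) ∷ (-1ℤ , 0ℤ) ∷ (0ℤ , 1ℤ) ∷ (0ℤ , -1ℤ) ∷ []

squareBoard : Board
squareBoard = record
  { Cell = Cell²
  ; Adj  = λ c d → Any (λ o → d ≡ c ⊕² o) squareOffsets }

-- Hexagonal tiling: hexagons indexed by axial coordinates (x , y);
-- the six neighbours are at the offsets below.
hexOffsets : List Cell²
hexOffsets = (1ℤ , 0ℤ) ∷ (-1ℤ , 0ℤ) ∷ (0ℤ , 1ℤ) ∷ (0ℤ , -1ℤ)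
           ∷ (1ℤ , -1ℤ) ∷ (-1ℤ , 1ℤ) ∷ []

hexagonalBoard : Board
hexagonalBoard = record
  { Cell = Cell²
  ; Adj  = λ c d → Any (λ o → d ≡ c ⊕² o) hexOffsets }

-- Triangular tiling: the lattice parallelogram at (x , y) (lattice basis
-- e₁, e₂ at 60°) is split into the "up" triangle (x , y , true) with
-- vertices (x,y),(x+1,y),(x,y+1) and the "down" triangle (x , y , false)
-- with vertices (x+1,y),(x,y+1),(x+1,y+1).
CellΔ : Set
CellΔ = ℤ × ℤ × Bool

TriAdj₀ : CellΔ → CellΔ → Set
TriAdj₀ (x , y , true) (x' , y' , false) =
  (x' ≡ x × y' ≡ y) ⊎ (x' ≡ x × y' ≡ y - 1ℤ) ⊎ (x' ≡ x - 1ℤ × y' ≡ y)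
TriAdj₀ _ _ = ⊥

triangularBoard : Board
triangularBoard = record
  { Cell = CellΔ
  ; Adj  = λ c d → TriAdj₀ c d ⊎ TriAdj₀ d c }

Cell³ : Set
Cell³ = ℤ × ℤ × ℤ

_⊕³_ : Cell³ → Cell³ → Cell³
(x , y , z) ⊕³ (u , v , w) = (x + u , y + v , z + w)

cubeOffsets : List Cell³
cubeOffsets = (1ℤ , 0ℤ , 0ℤ) ∷ (-1ℤ , 0ℤ , 0ℤ) ∷ (0ℤ , 1ℤ , 0ℤ)
            ∷ (0ℤ , -1ℤ , 0ℤ) ∷ (0ℤ , 0ℤ , 1ℤ) ∷ (0ℤ , 0ℤ , -1ℤ) ∷ []

cubicBoard : Board
cubicBoard = record
  { Cell = Cell³
  ; Adj  = λ c d → Any (λ o → d ≡ c ⊕³ o) cubeOffsets }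

data BoardKind : Set where
  square triangular hexagonal cubic : BoardKind

board : BoardKind → Board
board square      = squareBoard
board triangular  = triangularBoard
board hexagonal   = hexagonalBoard
board cubic       = cubicBoard

module Game (B : Board) where

  -- finite sets of cells are represented by lists (membership = _∈_)

  data PathIn (S : List (Cell B)) : Cell B → Cell B → Set where
    here : ∀ {y} → PathIn S y y
    step : ∀ {y w z} → Adj B y w → w ∈ S → PathIn S w z → PathIn S y z

  IsAnimal : List (Cell B) → Set
  IsAnimal A = Unique A × 0 < length A
             × (∀ {y z} → y ∈ A → z ∈ A → PathIn A y z)

  -- congruences of the board = symmetries of the tiling, i.e.
  -- automorphisms of the cell adjacency structure
  record Congruence : Set where
    field
      to    : Cell B → Cell B
      from  : Cell B → Cell B
      to∘from : ∀ c → to (from c) ≡ c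
      from∘to : ∀ c → from (to c) ≡ c
      adj   : ∀ c d → Adj B c d → Adj B (to c) (to d)
      adj⁻  : ∀ c d → Adj B (to c) (to d) → Adj B c d

  open Congruence public

  Congruent : List (Cell B) → List (Cell B) → Set
  Congruent A S = Σ Congruence λ φ →
      (∀ y → y ∈ S → ∃[ c ] (c ∈ A × to φ c ≡ y))
    × (∀ c → c ∈ A → to φ c ∈ S)

  ContainsCopy : List (Cell B) → List (Cell B) → Set
  ContainsCopy A M = ∃[ S ] (Congruent A S × All (_∈ M) S)

  LegalMove : ℕ → List (Cell B) → List (Cell B) → Set
  LegalMove m M c = length c ≡ m × Unique c × All (_∉ M) c

  -- one round: (maker's move , breaker's move)
  Round : Set
  Round = List (Cell B) × List (Cell B)

  marked : List Round → List (Cell B)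
  marked = concatMap (λ r → proj₁ r ++ proj₂ r)

  makerMarked : List Round → List (Cell B)
  makerMarked = concatMap proj₁

  MakerStrategy : ℕ → Set
  MakerStrategy a = (h : List Round) → Σ (List (Cell B)) (LegalMove a (marked h))

  BreakerStrategy : ℕ → Set
  BreakerStrategy b = (h : List Round) (c : List (Cell B))
                    → Σ (List (Cell B)) (LegalMove b (marked h ++ c))

  play : ∀ {a b} → MakerStrategy a → BreakerStrategy b → ℕ → List Round
  play σ τ zero    = []
  play σ τ (suc n) =
    let h = play σ τ n
        c = proj₁ (σ h)
        d = proj₁ (τ h c)
    in h ++ [ (c , d) ]

  IsWinner : ℕ → ℕ → List (Cell B) → Set
  IsWinner a b A = Σ (MakerStrategy a) λ σ → (τ : BreakerStrategy b)
                 → ∃[ n ] ContainsCopy A (makerMarked (play σ τ n))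

{-# OPTIONS --safe #-}
-- The maker wins in two turns.  Translating along the first coordinate is a
-- symmetry of each board, so the maker first marks a translates x + tⱼ of the
-- common cell x, spaced so far apart that the a translates of the flower
-- A₁ ∪ … ∪ Aₖ are pairwise disjoint.  The a·k translated petals Aᵢ ∖ {x} then
-- have a cells each, are pairwise disjoint and avoid the marked centres; the
-- breaker's b < a·k cells miss one of them, and the maker completes it.
module Submission where

open import Defs
open import Algebra.Bundles using (AbelianGroup)
open import Data.Bool using (true; false)
open import Data.Bool.Properties as Bool using ()
open import Data.Empty using (⊥-elim)
open import Data.Fin as Fin using (Fin; toℕ; remQuot)
open import Data.Fin.Properties as Fin using (pigeonhole; any?; combine-remQuot; toℕ-injective)
open import Data.Integer as ℤ using (ℤ; +_; -[1+_]; -_; ∣_∣)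
open import Data.Integer.Properties as ℤ using (+-injective; +-identityʳ; ⊖-≥)
open import Data.List using (List; []; _∷_; _++_; length; map; filter; lookup; allFin; upTo; concatMap)
open import Data.List.Extrema.Nat using (max; xs≤max)
open import Data.List.Membership.Propositional using (_∈_; _∉_; find; lose)
open import Data.List.Membership.Propositional.Properties
  using (∈-map⁺; ∈-map⁻; ∈-filter⁺; ∈-filter⁻; ∈-++⁺ˡ; ∈-++⁺ʳ; ∈-++⁻; ∈-allFin; ∈-concatMap⁺)
open import Data.List.Properties using (filter-accept; filter-reject; filter-all; length-map; length-upTo; length-tabulate)
open import Data.List.Relation.Binary.Disjoint.Propositional using (Disjoint)
open import Data.List.Relation.Unary.All as All using (All; all?)
open import Data.List.Relation.Unary.All.Properties as All using (¬All⇒Any¬)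
open import Data.List.Relation.Unary.AllPairs using (_∷_)
open import Data.List.Relation.Unary.Any as Any using (Any; here; there)
open import Data.List.Relation.Unary.Any.Properties using (lookup-index)
open import Data.List.Relation.Unary.Unique.Propositional using (Unique)
open import Data.List.Relation.Unary.Unique.Propositional.Properties as Unique using ()
open import Data.Nat using (ℕ; zero; suc; _+_; _*_; _∸_; _≤_; _<_; _%_; s≤s)
open import Data.Nat.DivMod using (m<n⇒m%n≡m; [m+kn]%n≡m%n)
open import Data.Nat.Properties using (≮⇒≥; <⇒≱; 1+n≢0; suc-injective; ≤-trans; m≤m+n; m∸n≤m; +-monoˡ-≤; +-cancelˡ-≡; *-cancelʳ-≡)
open import Data.Product using (Σ; ∃; _×_; _,_; proj₁; proj₂; uncurry)
open import Data.Product.Properties using (≡-dec)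
open import Data.Sum using (inj₁; inj₂)
open import Function using (_∘_)
open import Relation.Binary.Definitions using (DecidableEquality)
open import Relation.Binary.PropositionalEquality
open import Relation.Nullary using (¬_; ¬?; yes; no; Dec; contradiction)
open import Relation.Nullary.Decidable using (decidable-stable)

open import Algebra.Properties.Group (AbelianGroup.group ℤ.+-0-abelianGroup)
  using (//-rightDividesˡ; //-rightDividesʳ)
open import Algebra.Properties.CommutativeSemigroup ℤ.+-commutativeSemigroup
  using (xy∙z≈xz∙y)

module _ {X : Set} (_≟_ : DecidableEquality X) where

  without : X → List X → List X
  without y = filter (λ z → ¬? (z ≟ y))

  ∈-without⁻ : ∀ {y z xs} → z ∈ without y xs → z ∈ xs × z ≢ y
  ∈-without⁻ {y} = ∈-filter⁻ (λ z → ¬? (z ≟ y))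

  ∈-without⁺ : ∀ {y z xs} → z ∈ xs → z ≢ y → z ∈ without y xs
  ∈-without⁺ {y} = ∈-filter⁺ (λ z → ¬? (z ≟ y))

  without-unique : ∀ {y xs} → Unique xs → Unique (without y xs)
  without-unique {y} = Unique.filter⁺ (λ z → ¬? (z ≟ y))

  length-without : ∀ {y xs} → Unique xs → y ∈ xs → suc (length (without y xs)) ≡ length xs
  length-without {y} {x ∷ xs} (x∉xs ∷ _) (here refl) =
    cong (suc ∘ length) (trans (filter-reject (λ z → ¬? (z ≟ y)) (λ y≢y → y≢y refl))
                                (filter-all (λ z → ¬? (z ≟ y)) (All.map (λ x≢z → x≢z ∘ sym) x∉xs)))
  length-without {y} {x ∷ xs} (x∉xs ∷ u) (there y∈xs) =
    cong suc (trans (cong length (filter-accept (λ z → ¬? (z ≟ y)) (All.lookup x∉xs y∈xs)))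
                    (length-without u y∈xs))

disjoint-hitting-≤ : ∀ {X : Set} {n} (F : Fin n → List X) →
  (∀ {i j} → i ≢ j → Disjoint (F i) (F j)) →
  (d : List X) → (∀ i → Any (_∈ d) (F i)) → n ≤ length d
disjoint-hitting-≤ {X} {n} F disjoint d hits = ≮⇒≥ no-collision
  where
  hit : Fin n → X
  hit i = proj₁ (find (hits i))

  hit∈F : ∀ i → hit i ∈ F i
  hit∈F i = proj₁ (proj₂ (find (hits i)))

  hit∈d : ∀ i → hit i ∈ d
  hit∈d i = proj₂ (proj₂ (find (hits i)))

  no-collision : ¬ length d < n
  no-collision ∣d∣<n with i , j , i<j , same-index ← pigeonhole ∣d∣<n (Any.index ∘ hit∈d) =
    disjoint (Fin.<⇒≢ i<j) (hit∈F i , subst (_∈ F j) (sym same-hit) (hit∈F j))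
    where
    same-hit : hit i ≡ hit j
    same-hit = trans (lookup-index (hit∈d i))
                     (trans (cong (lookup d) same-index) (sym (lookup-index (hit∈d j))))

quotient-unique : ∀ {e n n' m m'} → n < suc e → n' < suc e →
  n + m * suc e ≡ n' + m' * suc e → m ≡ m'
quotient-unique {e} {n} {n'} {m} {m'} n<E n'<E eq =
  *-cancelʳ-≡ m m' (suc e) (+-cancelˡ-≡ n _ _ (trans eq (cong (_+ m' * suc e) (sym n≡n'))))
  where
  open ≡-Reasoning
  n≡n' : n ≡ n'
  n≡n' = begin
    n                    ≡⟨ m<n⇒m%n≡m n<E ⟨
    n % suc e            ≡⟨ [m+kn]%n≡m%n n m (suc e) ⟨
    (n + m * suc e) % suc e   ≡⟨ cong (_% suc e) eq ⟩
    (n' + m' * suc e) % suc e ≡⟨ [m+kn]%n≡m%n n' m' (suc e) ⟩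
    n' % suc e           ≡⟨ m<n⇒m%n≡m n'<E ⟩
    n'                   ∎

offset-into-ℕ : ∀ {r} i → ∣ i ∣ ≤ r → ∃ λ n → n < suc (r + r) × i ℤ.+ + r ≡ + n
offset-into-ℕ {r} (+ m)    m≤r = m + r , s≤s (+-monoˡ-≤ r m≤r) , refl
offset-into-ℕ {r} -[1+ m ] m<r = r ∸ suc m , s≤s (≤-trans (m∸n≤m r (suc m)) (m≤m+n r r)) , ⊖-≥ m<r

bounded-translates-separate : ∀ {r m m'} i j → ∣ i ∣ ≤ r → ∣ j ∣ ≤ r →
  i ℤ.+ + (m * suc (r + r)) ≡ j ℤ.+ + (m' * suc (r + r)) → m ≡ m'
bounded-translates-separate {r} {m} {m'} i j ∣i∣≤r ∣j∣≤r eq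
  with n , n<E , i+r≡n ← offset-into-ℕ i ∣i∣≤r
     | n' , n'<E , j+r≡n' ← offset-into-ℕ j ∣j∣≤r =
  quotient-unique n<E n'<E (+-injective (begin
    + (n + m * E)                ≡⟨ cong (ℤ._+ + (m * E)) i+r≡n ⟨
    (i ℤ.+ + r) ℤ.+ + (m * E)    ≡⟨ xy∙z≈xz∙y i (+ r) (+ (m * E)) ⟩
    (i ℤ.+ + (m * E)) ℤ.+ + r    ≡⟨ cong (ℤ._+ + r) eq ⟩
    (j ℤ.+ + (m' * E)) ℤ.+ + r   ≡⟨ xy∙z≈xz∙y j (+ (m' * E)) (+ r) ⟩
    (j ℤ.+ + r) ℤ.+ + (m' * E)   ≡⟨ cong (ℤ._+ + (m' * E)) j+r≡n' ⟩
    + (n' + m' * E)              ∎))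
  where
  open ≡-Reasoning
  E : ℕ
  E = suc (r + r)

module _ {B : Board} where
  open Game B

  to-injective : (φ : Congruence) → ∀ {c c'} → to φ c ≡ to φ c' → c ≡ c'
  to-injective φ {c} {c'} eq = trans (sym (from∘to φ c)) (trans (cong (from φ) eq) (from∘to φ c'))

  _∘ᶜ_ : Congruence → Congruence → Congruence
  φ ∘ᶜ ψ = record
    { to      = to φ ∘ to ψ
    ; from    = from ψ ∘ from φ
    ; to∘from = λ c → trans (cong (to φ) (to∘from ψ (from φ c))) (to∘from φ c)
    ; from∘to = λ c → trans (cong (from ψ) (from∘to φ (to ψ c))) (from∘to ψ c)
    ; adj     = λ c d → adj φ _ _ ∘ adj ψ c d
    ; adj⁻    = λ c d → adj⁻ ψ c d ∘ adj⁻ φ _ _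
    }

  image-congruent : (φ : Congruence) (A : List (Cell B)) → Congruent A (map (to φ) A)
  image-congruent φ A = φ , (λ y y∈ → let c , c∈A , y≡ = ∈-map⁻ (to φ) y∈ in c , c∈A , sym y≡)
                          , (λ c → ∈-map⁺ (to φ))

record Translations (B : Board) : Set where
  field
    _≟_          : DecidableEquality (Cell B)
    height       : Cell B → ℤ
    shift        : ℤ → Game.Congruence B
    height-shift : ∀ s c → height (Game.to (shift s) c) ≡ height c ℤ.+ s

shiftColumn : {R : Set} → ℤ → ℤ × R → ℤ × R
shiftColumn s (x , r) = (x ℤ.+ s , r)

columnTranslations : {R : Set} → DecidableEquality R → {Adj : ℤ × R → ℤ × R → Set} →
  (∀ s {c d} → Adj c d → Adj (shiftColumn s c) (shiftColumn s d)) →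
  Translations (record { Cell = ℤ × R ; Adj = Adj })
columnTranslations _≟ᴿ_ {Adj} adj-shift = record
  { _≟_          = ≡-dec ℤ._≟_ _≟ᴿ_
  ; height       = proj₁
  ; shift        = λ s → record
    { to      = shiftColumn s
    ; from    = shiftColumn (- s)
    ; to∘from = reshift s
    ; from∘to = unshift s
    ; adj     = λ _ _ → adj-shift s
    ; adj⁻    = λ c d → subst₂ Adj (unshift s c) (unshift s d) ∘ adj-shift (- s)
    }
  ; height-shift = λ _ _ → refl
  }
  where
  cancel : ∀ s t → (∀ x → (x ℤ.+ s) ℤ.+ t ≡ x) → ∀ c → shiftColumn t (shiftColumn s c) ≡ c
  cancel s t cancel-x (x , r) = cong (_, r) (cancel-x x)

  unshift : ∀ s c → shiftColumn (- s) (shiftColumn s c) ≡ c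
  unshift s = cancel s (- s) (//-rightDividesʳ s)

  reshift : ∀ s c → shiftColumn s (shiftColumn (- s) c) ≡ c
  reshift s = cancel (- s) s (//-rightDividesˡ s)

offset-adj-shift : ∀ (offsets : List Cell²) s {c d : Cell²} →
  Any (λ o → d ≡ c ⊕² o) offsets → Any (λ o → shiftColumn s d ≡ shiftColumn s c ⊕² o) offsets
offset-adj-shift _ s {x , y} = Any.map λ { {u , v} refl → cong (_, y ℤ.+ v) (xy∙z≈xz∙y x u s) }

cubic-adj-shift : ∀ s {c d : Cell³} →
  Adj cubicBoard c d → Adj cubicBoard (shiftColumn s c) (shiftColumn s d)
cubic-adj-shift s {x , y , z} = Any.map λ { {u , v , w} refl → cong (_, y ℤ.+ v , z ℤ.+ w) (xy∙z≈xz∙y x u s) }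

TriAdj₀-shift : ∀ s c d → TriAdj₀ c d → TriAdj₀ (shiftColumn s c) (shiftColumn s d)
TriAdj₀-shift s (x , y , true) (x' , y' , false) (inj₁ (refl , y'≡)) = inj₁ (refl , y'≡)
TriAdj₀-shift s (x , y , true) (x' , y' , false) (inj₂ (inj₁ (refl , y'≡))) = inj₂ (inj₁ (refl , y'≡))
TriAdj₀-shift s (x , y , true) (x' , y' , false) (inj₂ (inj₂ (refl , y'≡))) =
  inj₂ (inj₂ (xy∙z≈xz∙y x ℤ.-1ℤ s , y'≡))

triangular-adj-shift : ∀ s {c d : CellΔ} →
  Adj triangularBoard c d → Adj triangularBoard (shiftColumn s c) (shiftColumn s d)
triangular-adj-shift s {c} {d} (inj₁ c▵d) = inj₁ (TriAdj₀-shift s c d c▵d)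
triangular-adj-shift s {c} {d} (inj₂ d▵c) = inj₂ (TriAdj₀-shift s d c d▵c)

translations : ∀ κ → Translations (board κ)
translations square     = columnTranslations ℤ._≟_ (offset-adj-shift squareOffsets)
translations triangular = columnTranslations (≡-dec ℤ._≟_ Bool._≟_) triangular-adj-shift
translations hexagonal  = columnTranslations ℤ._≟_ (offset-adj-shift hexOffsets)
translations cubic      = columnTranslations (≡-dec ℤ._≟_ ℤ._≟_) cubic-adj-shift

module Spreading {B : Board} (T : Translations B) where
  open Game B
  open Translations T

  -- Opaque because unfolding max makes type checking very slow.
  opaque
    radius : List (Cell B) → ℕ
    radius L = max 0 (map (∣_∣ ∘ height) L)

    radius-bounds : ∀ {y L} → y ∈ L → ∣ height y ∣ ≤ radius L
    radius-bounds {L = L} y∈L = All.lookup (xs≤max 0 (map (∣_∣ ∘ height) L)) (∈-map⁺ (∣_∣ ∘ height) y∈L)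

  spread : ℕ → ℕ → Congruence
  spread r m = shift (+ (m * suc (r + r)))

  height-spread-separates : ∀ {r m m' p q} → ∣ height p ∣ ≤ r → ∣ height q ∣ ≤ r →
    height (to (spread r m) p) ≡ height q ℤ.+ + (m' * suc (r + r)) → m ≡ m'
  height-spread-separates {p = p} {q} ∣p∣≤r ∣q∣≤r eq =
    bounded-translates-separate (height p) (height q) ∣p∣≤r ∣q∣≤r (trans (sym (height-shift _ p)) eq)

  spread-separates : ∀ {r m m' p q} → ∣ height p ∣ ≤ r → ∣ height q ∣ ≤ r →
    to (spread r m) p ≡ to (spread r m') q → m ≡ m' × p ≡ q
  spread-separates {r} {m} {m'} {q = q} ∣p∣≤r ∣q∣≤r eq with refl ←
    height-spread-separates {m = m} {m'} ∣p∣≤r ∣q∣≤r (trans (cong height eq) (height-shift _ q)) =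
    refl , to-injective (spread r m) eq

  freshMove : Cell B → (a : ℕ) (M : List (Cell B)) → Σ (List (Cell B)) (LegalMove a M)
  freshMove c a M = map far (upTo a) , length-far , Unique.map⁺ far-injective (Unique.upTo⁺ a)
                  , All.map⁺ (All.universal far∉M (upTo a))
    where
    r : ℕ
    r = radius (c ∷ M)

    bounded : ∀ {y} → y ∈ c ∷ M → ∣ height y ∣ ≤ r
    bounded = radius-bounds

    far : ℕ → Cell B
    far t = to (spread r (suc t)) c

    length-far : length (map far (upTo a)) ≡ a
    length-far = trans (length-map far (upTo a)) (length-upTo a)

    far-injective : ∀ {t t'} → far t ≡ far t' → t ≡ t'
    far-injective eq = suc-injective (proj₁ (spread-separates {r} (bounded (here refl)) (bounded (here refl)) eq))

    far∉M : ∀ t → far t ∉ M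
    far∉M t far∈M with y , y∈M , refl ← find far∈M =
      1+n≢0 (height-spread-separates {r} {suc t} {0} (bounded (here refl)) (bounded (there y∈M))
                                     (sym (+-identityʳ (height y))))

module Flower {B : Board} (T : Translations B) (A : List (Cell B)) {a k : ℕ}
  (unique-A : Unique A) (∣A∣≡1+a : length A ≡ suc a)
  (P : Fin k → List (Cell B)) (placed : ∀ i → Game.Congruent B A (P i))
  (x : Cell B) (x∈P : ∀ i → x ∈ P i)
  (meet-at-x : ∀ {i j} → i ≢ j → ∀ {y} → y ∈ P i → y ∈ P j → y ≡ x) where

  open Game B
  open Translations T
  open Spreading T
  open import Data.List.Membership.DecPropositional _≟_ using (_∈?_)

  ψ : Fin k → Congruence
  ψ i = proj₁ (placed i)

  ψ⁻¹x : ∀ i → ∃ λ c → c ∈ A × to (ψ i) c ≡ x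
  ψ⁻¹x i = proj₁ (proj₂ (placed i)) x (x∈P i)

  stem : Fin k → Cell B
  stem i = proj₁ (ψ⁻¹x i)

  ψ-stem : ∀ i → to (ψ i) (stem i) ≡ x
  ψ-stem i = proj₂ (proj₂ (ψ⁻¹x i))

  petal : Fin k → List (Cell B)
  petal i = map (to (ψ i)) (without _≟_ (stem i) A)

  length-petal : ∀ i → length (petal i) ≡ a
  length-petal i = trans (length-map (to (ψ i)) (without _≟_ (stem i) A))
                         (suc-injective (trans (length-without _≟_ unique-A (proj₁ (proj₂ (ψ⁻¹x i)))) ∣A∣≡1+a))

  petal-unique : ∀ i → Unique (petal i)
  petal-unique i = Unique.map⁺ (to-injective (ψ i)) (without-unique _≟_ unique-A)

  petal⊆P : ∀ {i y} → y ∈ petal i → y ∈ P i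
  petal⊆P {i} y∈ with c , c∈ , refl ← ∈-map⁻ (to (ψ i)) y∈ =
    proj₂ (proj₂ (placed i)) c (proj₁ (∈-without⁻ _≟_ {xs = A} c∈))

  x∉petal : ∀ {i y} → y ∈ petal i → y ≢ x
  x∉petal {i} y∈ y≡x with c , c∈ , refl ← ∈-map⁻ (to (ψ i)) y∈ =
    proj₂ (∈-without⁻ _≟_ {xs = A} c∈) (to-injective (ψ i) (trans y≡x (sym (ψ-stem i))))

  petals-disjoint : ∀ {i j} → i ≢ j → Disjoint (petal i) (petal j)
  petals-disjoint i≢j (y∈i , y∈j) = x∉petal y∈i (meet-at-x i≢j (petal⊆P y∈i) (petal⊆P y∈j))

  r : ℕ
  r = radius (x ∷ concatMap P (allFin k))

  x-bounded : ∣ height x ∣ ≤ r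
  x-bounded = radius-bounds (here refl)

  P-bounded : ∀ {i y} → y ∈ P i → ∣ height y ∣ ≤ r
  P-bounded {i} {y} y∈P = radius-bounds
    (there (∈-concatMap⁺ P (Any.map (λ i≡j → subst (λ j → y ∈ P j) i≡j y∈P) (∈-allFin i))))

  petal-bounded : ∀ {i y} → y ∈ petal i → ∣ height y ∣ ≤ r
  petal-bounded = P-bounded ∘ petal⊆P

  translate : Fin a → Congruence
  translate j = spread r (toℕ j)

  translate-separates : ∀ j j' {y y'} → ∣ height y ∣ ≤ r → ∣ height y' ∣ ≤ r →
    to (translate j) y ≡ to (translate j') y' → j ≡ j' × y ≡ y'
  translate-separates _ _ ∣y∣≤r ∣y'∣≤r eq with toℕj≡toℕj' , y≡y' ← spread-separates {r} ∣y∣≤r ∣y'∣≤r eq =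
    toℕ-injective toℕj≡toℕj' , y≡y'

  centres : List (Cell B)
  centres = map (λ j → to (translate j) x) (allFin a)

  length-centres : length centres ≡ a
  length-centres = trans (length-map _ (allFin a)) (length-tabulate (λ j → j))

  centres-unique : Unique centres
  centres-unique = Unique.map⁺ (λ {j} {j'} → proj₁ ∘ translate-separates j j' x-bounded x-bounded) (Unique.allFin⁺ a)

  arm : Fin a × Fin k → List (Cell B)
  arm (j , i) = map (to (translate j)) (petal i)

  length-arm : ∀ ι → length (arm ι) ≡ a
  length-arm (j , i) = trans (length-map (to (translate j)) (petal i)) (length-petal i)

  arm-unique : ∀ ι → Unique (arm ι)
  arm-unique (j , i) = Unique.map⁺ (to-injective (translate j)) (petal-unique i)

  arm-avoids-centres : ∀ ι → Disjoint (arm ι) centres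
  arm-avoids-centres (j , i) (y∈arm , y∈centres)
    with c , c∈petal , refl ← ∈-map⁻ (to (translate j)) y∈arm
       | j' , _ , eq ← ∈-map⁻ (λ j → to (translate j) x) y∈centres =
    x∉petal c∈petal (proj₂ (translate-separates j j' (petal-bounded c∈petal) x-bounded eq))

  translated-petals-meet : ∀ {j j' i i' c c'} → c ∈ petal i → c' ∈ petal i' →
    to (translate j) c ≡ to (translate j') c' → (j , i) ≡ (j' , i')
  translated-petals-meet {j} {j'} {i} {i'} c∈ c'∈ eq
    with refl , refl ← translate-separates j j' (petal-bounded c∈) (petal-bounded c'∈) eq | i Fin.≟ i'
  ... | yes refl = refl
  ... | no i≢i' = ⊥-elim (petals-disjoint i≢i' (c∈ , c'∈))

  arms-disjoint : ∀ {ι ι'} → ι ≢ ι' → Disjoint (arm ι) (arm ι')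
  arms-disjoint {j , i} {j' , i'} ι≢ι' (y∈ , y∈')
    with c , c∈ , refl ← ∈-map⁻ (to (translate j)) y∈
       | c' , c'∈ , eq ← ∈-map⁻ (to (translate j')) y∈' =
    ι≢ι' (translated-petals-meet c∈ c'∈ eq)

  arm-completes : ∀ ι → ContainsCopy A (centres ++ (arm ι ++ []))
  arm-completes (j , i) = map (to φ) A , image-congruent φ A , All.map⁺ (All.tabulate image∈)
    where
    φ : Congruence
    φ = translate j ∘ᶜ ψ i

    image∈ : ∀ {c} → c ∈ A → to φ c ∈ centres ++ (arm (j , i) ++ [])
    image∈ {c} c∈A with c ≟ stem i
    ... | yes refl = ∈-++⁺ˡ (subst (_∈ centres) (cong (to (translate j)) (sym (ψ-stem i)))
                                   (∈-map⁺ (λ j → to (translate j) x) (∈-allFin j)))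
    ... | no c≢stem = ∈-++⁺ʳ centres (∈-++⁺ˡ (∈-map⁺ (to (translate j))
                        (∈-map⁺ (to (ψ i)) (∈-without⁺ _≟_ c∈A c≢stem))))

  armAt : Fin (a * k) → List (Cell B)
  armAt = arm ∘ remQuot k

  armsAt-disjoint : ∀ {ι ι'} → ι ≢ ι' → Disjoint (armAt ι) (armAt ι')
  armsAt-disjoint {ι} {ι'} ι≢ι' = arms-disjoint (ι≢ι' ∘ remQuot-injective)
    where
    remQuot-injective : remQuot k ι ≡ remQuot k ι' → ι ≡ ι'
    remQuot-injective eq = trans (sym (combine-remQuot {a} k ι))
                                 (trans (cong (uncurry Fin.combine) eq) (combine-remQuot {a} k ι'))

  Unmarked : List (Cell B) → Fin (a * k) → Set
  Unmarked M ι = All (_∉ M) (armAt ι)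

  unmarked? : ∀ M ι → Dec (Unmarked M ι)
  unmarked? M ι = all? (λ y → ¬? (y ∈? M)) (armAt ι)

  nextMove : (M : List (Cell B)) → Dec (∃ (Unmarked M)) → Σ (List (Cell B)) (LegalMove a M)
  nextMove M (yes (ι , unmarked)) = armAt ι , length-arm (remQuot k ι) , arm-unique (remQuot k ι) , unmarked
  nextMove M (no _)               = freshMove x a M

  -- Only the first two turns matter; later moves merely have to be legal.
  strategy : MakerStrategy a
  strategy []          = centres , length-centres , centres-unique , All.universal (λ _ ()) centres
  strategy h@(_ ∷ _)   = nextMove (marked h) (any? (unmarked? (marked h)))

  breaker-hits-every-arm : ∀ d → ¬ ∃ (Unmarked (marked ((centres , d) ∷ []))) → ∀ ι → Any (_∈ d) (armAt ι)
  breaker-hits-every-arm d none ι =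
    let y , y∈arm , y∈M = find marked-cell in lose y∈arm (in-d y∈arm y∈M)
    where
    M : List (Cell B)
    M = marked ((centres , d) ∷ [])

    marked-cell : Any (_∈ M) (armAt ι)
    marked-cell = Any.map (decidable-stable (_ ∈? M))
                          (¬All⇒Any¬ (λ y → ¬? (y ∈? M)) (armAt ι) (λ unmarked → none (ι , unmarked)))

    in-d : ∀ {y} → y ∈ armAt ι → y ∈ M → y ∈ d
    in-d y∈arm y∈M with ∈-++⁻ (centres ++ d) y∈M
    ... | inj₂ ()
    ... | inj₁ y∈c++d with ∈-++⁻ centres y∈c++d
    ...   | inj₁ y∈c = ⊥-elim (arm-avoids-centres (remQuot k ι) (y∈arm , y∈c))
    ...   | inj₂ y∈d = y∈d

  winner : ∀ {b} → b < a * k → IsWinner a b A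
  winner {b} b<ak = strategy , λ breaker →
    let d , ∣d∣≡b , _ = breaker [] centres
    in 2 , completes d (subst (_< a * k) (sym ∣d∣≡b) b<ak) (any? (unmarked? (marked ((centres , d) ∷ []))))
    where
    completes : ∀ d → length d < a * k → (D : Dec (∃ (Unmarked (marked ((centres , d) ∷ []))))) →
                ContainsCopy A (centres ++ (proj₁ (nextMove (marked ((centres , d) ∷ [])) D) ++ []))
    completes d _     (yes (ι , _)) = arm-completes (remQuot k ι)
    completes d ∣d∣<ak (no none)    =
      contradiction (disjoint-hitting-≤ armAt armsAt-disjoint d (breaker-hits-every-arm d none)) (<⇒≱ ∣d∣<ak)

module _ {B : Board} where
  open Game B

  flower-centre : ∀ {A : List (Cell B)} {k} → 0 < length A →
    (P : Fin k → List (Cell B)) → (∀ i → Congruent A (P i)) → (x : Cell B) →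
    (∀ i j → i ≢ j → ∀ y → ((y ∈ P i × y ∈ P j) → y ≡ x) × (y ≡ x → y ∈ P i × y ∈ P j)) →
    ∃ λ c → (∀ i → c ∈ P i) × (∀ {i j} → i ≢ j → ∀ {y} → y ∈ P i → y ∈ P j → y ≡ c)
  flower-centre {k = zero} _ P _ x _ = x , (λ ()) , λ { {()} }
  flower-centre {[]} {k = 1} ()
  -- For k = 1 the hypothesis says nothing about x; any cell of P 0 is a centre.
  flower-centre {c ∷ _} {k = 1} _ P placed _ _ =
    to (proj₁ (placed Fin.zero)) c , (λ { Fin.zero → proj₂ (proj₂ (placed Fin.zero)) c (here refl) })
    , λ { {Fin.zero} {Fin.zero} 0≢0 → ⊥-elim (0≢0 refl) }
  flower-centre {k = suc (suc _)} _ P _ x meet = x , x∈P , λ i≢j y∈Pi y∈Pj → proj₁ (meet _ _ i≢j _) (y∈Pi , y∈Pj)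
    where
    x∈P : ∀ i → x ∈ P i
    x∈P Fin.zero    = proj₁ (proj₂ (meet Fin.zero (Fin.suc Fin.zero) (λ ()) x) refl)
    x∈P (Fin.suc i) = proj₂ (proj₂ (meet Fin.zero (Fin.suc i) (λ ()) x) refl)

proposition2p2 : (κ : BoardKind) (A : List (Cell (board κ))) (a b k : ℕ)
    → 1 ≤ a
    → Game.IsAnimal (board κ) A
    → length A ≡ suc a
    → (P : Fin k → List (Cell (board κ)))
    → (∀ i → Game.Congruent (board κ) A (P i))
    → (x : Cell (board κ))
    → (∀ i j → i ≢ j → ∀ y → ((y ∈ P i × y ∈ P j) → y ≡ x) × (y ≡ x → y ∈ P i × y ∈ P j))
    → b < a * k
    → Game.IsWinner (board κ) a b A
-- The hypothesis 1 ≤ a is implied by b < a * k.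
proposition2p2 κ A a b k _ (unique-A , 0<∣A∣ , _) ∣A∣≡1+a P placed x meet b<ak =
  let c , c∈P , meet-at-c = flower-centre 0<∣A∣ P placed x meet
  in Flower.winner (translations κ) A unique-A ∣A∣≡1+a P placed c c∈P meet-at-c b<ak
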